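{- Let $\mu,\nu\in\mathbb{C}$ and let $X,Y$ satisfy $XY-YX=\mu I+\nu Y$. Define the Ore-Stirling numbers $S_{\mu,\nu}(n;j,k)$ as the coefficient of $Y^jX^k$ in the normal ordered expansion of $(YX)^n$, i.e. $(YX)^n=\sum_{j,k\ge0}S_{\mu,\nu}(n;j,k)Y^jX^k$, with $S_{\mu,\nu}(n;j,k)=0$ if $j<0$ or $k<0$. Then for all $n\ge0$, $j\ge1$, $k\ge0$, $$S_{\mu,\nu}(n+1;j,k)=S_{\mu,\nu}(n;j-1,k-1)+\mu j\,S_{\mu,\nu}(n;j,k)+\nu(j-1)\,S_{\mu,\nu}(n;j-1,k).$$
   Context: The monomials $Y^jX^k$ ($j,k\ge0$) form a linear basis of the complex unital algebra generated by $X,Y$ with $XY-YX=\mu I+\nu Y$, so the normal ordering coefficients are well defined. -}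

module Defs where

open import Level using (Level)
open import Algebra.Bundles using (CommutativeRing)
open import Data.Nat as ℕ using (ℕ; zero; suc)
open import Data.Integer as ℤ using (ℤ; +_; -[1+_])
open import Data.List using (List; []; _∷_; _++_; map; concatMap; replicate; concat)
open import Data.Product using (_×_; _,_)
open import Relation.Nullary using (yes; no)

data Letter : Set where
  X Y : Letter

-- An element is represented as a formal linear combination (a finite list of
-- terms  c · Y^j X^k  encoded as (c , j , k)); by the basis property of the
-- monomials Y^j X^k the coefficient of Y^j X^k is the sum of the c's attached
-- to (j , k).
module OreStirling {c ℓ : Level} (R : CommutativeRing c ℓ)
                   (μ ν : CommutativeRing.Carrier R) where
  open CommutativeRing R

  Term : Set c
  Term = Carrier × ℕ × ℕ

  Elt : Set c
  Elt = List Term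

  Ymul : Elt → Elt
  Ymul = map (λ { (a , j , k) → (a , suc j , k) })

  Xpow : ℕ → Elt → Elt
  Xpow m = map (λ { (a , j , k) → (a , j , k ℕ.+ m) })

  scale : Carrier → Elt → Elt
  scale a = map (λ { (b , j , k) → (a * b , j , k) })

  -- normal form of X · Y^j, using X Y^(j+1) = (YX + μ + νY) Y^j
  --                                          = Y (X Y^j) + μ Y^j + ν Y^(j+1)
  XY^ : ℕ → Elt
  XY^ zero    = (1# , 0 , 1) ∷ []
  XY^ (suc j) = Ymul (XY^ j) ++ ((μ , j , 0) ∷ (ν , suc j , 0) ∷ [])

  Xmul : Elt → Elt
  Xmul = concatMap (λ { (a , j , k) → scale a (Xpow k (XY^ j)) })

  nf : List Letter → Elt
  nf []      = (1# , 0 , 0) ∷ []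
  nf (X ∷ w) = Xmul (nf w)
  nf (Y ∷ w) = Ymul (nf w)

  coeff : Elt → ℕ → ℕ → Carrier
  coeff [] j k = 0#
  coeff ((a , j' , k') ∷ t) j k with j' ℕ.≟ j | k' ℕ.≟ k
  ... | yes _ | yes _ = a + coeff t j k
  ... | _     | _     = coeff t j k

  YXpow : ℕ → List Letter
  YXpow n = concat (replicate n (Y ∷ X ∷ []))

  S : ℕ → ℤ → ℤ → Carrier
  S n (+ j) (+ k) = coeff (nf (YXpow n)) j k
  S n _     _     = 0#

  fromℕ : ℕ → Carrier
  fromℕ zero    = 0#
  fromℕ (suc m) = 1# + fromℕ m

  fromℤ : ℤ → Carrier
  fromℤ (+ m)      = fromℕ m
  fromℤ -[1+ m ]   = - fromℕ (suc m)

-- Left multiplication by X acts on the coefficient array of a normal ordered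
-- element as a fixed linear operator: by induction on j, from XY = YX + μ + νY,
--   X Y^j = Y^j X + j μ Y^(j-1) + j ν Y^j,
-- so the coefficient of Y^j X^k in X·e collects the coefficient of Y^j X^(k-1),
-- (j+1) μ times that of Y^(j+1) X^k, and j ν times that of Y^j X^k.
-- Since (YX)^(n+1) = Y · X · (YX)^n and left multiplication by Y only shifts j,
-- the recurrence is this operator read off at (j-1, k).
module Submission where

open import Defs
open import Level using (Level)
open import Algebra.Bundles using (CommutativeRing)
open import Data.Nat using (ℕ; suc)
open import Data.Integer as ℤ using (ℤ; +_)
open import Data.Nat as ℕ using (zero; _<_; _≤_; _<?_; s≤s)
open import Data.Nat.Properties as ℕ using (<⇒≢; ≮⇒≥; m≤n+m; <-≤-trans; m∸n+n≡m)
open import Data.List using ([]; _∷_; _++_)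
open import Data.Product using (_,_)
open import Data.Empty using (⊥-elim)
open import Relation.Nullary using (yes; no)
open import Relation.Binary.PropositionalEquality as ≡ using (_≡_; _≢_)

module NormalOrdering {c ℓ : Level} (R : CommutativeRing c ℓ) (μ ν : CommutativeRing.Carrier R) where
  open CommutativeRing R hiding (zero)
  open OreStirling R μ ν
  open import Relation.Binary.Reasoning.Setoid setoid
  open import Algebra.Solver.Ring.NaturalCoefficients.Default commutativeSemiring
    using (solve; con; _:*_; _:+_; _:=_)

  ≡⇒≈ : ∀ {x y} → x ≡ y → x ≈ y
  ≡⇒≈ ≡.refl = refl

  zero-summandˡ : ∀ a {x} y → x ≈ 0# → a * x + y ≈ y
  zero-summandˡ a y x≈0 = trans (+-congʳ (trans (*-congˡ x≈0) (zeroʳ a))) (+-identityˡ y)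

  δ : ℕ → ℕ → Carrier
  δ zero    zero    = 1#
  δ zero    (suc _) = 0#
  δ (suc _) zero    = 0#
  δ (suc a) (suc b) = δ a b

  δ-refl : ∀ a → δ a a ≡ 1#
  δ-refl zero    = ≡.refl
  δ-refl (suc a) = δ-refl a

  δ-≢ : ∀ {a b} → a ≢ b → δ a b ≡ 0#
  δ-≢ {zero}  {zero}  a≢b = ⊥-elim (a≢b ≡.refl)
  δ-≢ {zero}  {suc b} a≢b = ≡.refl
  δ-≢ {suc a} {zero}  a≢b = ≡.refl
  δ-≢ {suc a} {suc b} a≢b = δ-≢ (λ a≡b → a≢b (≡.cong suc a≡b))

  δ-+ˡ : ∀ m a b → δ (m ℕ.+ a) (m ℕ.+ b) ≡ δ a b
  δ-+ˡ zero    a b = ≡.refl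
  δ-+ˡ (suc m) a b = δ-+ˡ m a b

  δ-+ʳ : ∀ m a b → δ (a ℕ.+ m) (b ℕ.+ m) ≡ δ a b
  δ-+ʳ m a b rewrite ℕ.+-comm a m | ℕ.+-comm b m = δ-+ˡ m a b

  Coeffs : Set c
  Coeffs = ℕ → ℕ → Carrier

  lowerX : Coeffs → Coeffs
  lowerX f j zero    = 0#
  lowerX f j (suc k) = f j k

  Xmul-coeffs : Coeffs → Coeffs
  Xmul-coeffs f j k = (lowerX f j k + (μ * fromℕ (suc j)) * f (suc j) k) + (ν * fromℕ j) * f j k

  lowerX-linear : ∀ (a : Carrier) (f g : Coeffs) j k →
    lowerX (λ j k → a * f j k + g j k) j k ≈ a * lowerX f j k + lowerX g j k
  lowerX-linear a f g j zero    = sym (trans (+-identityʳ _) (zeroʳ a))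
  lowerX-linear a f g j (suc k) = refl

  Xmul-coeffs-linear : ∀ (a : Carrier) (f g : Coeffs) j k →
    Xmul-coeffs (λ j k → a * f j k + g j k) j k ≈ a * Xmul-coeffs f j k + Xmul-coeffs g j k
  Xmul-coeffs-linear a f g j k =
    trans (+-congʳ (+-congʳ (lowerX-linear a f g j k)))
      (solve 9 (λ a F₀ F₁ F₂ G₀ G₁ G₂ M N →
          ((a :* F₀ :+ G₀) :+ M :* (a :* F₁ :+ G₁)) :+ N :* (a :* F₂ :+ G₂)
          := a :* ((F₀ :+ M :* F₁) :+ N :* F₂) :+ ((G₀ :+ M :* G₁) :+ N :* G₂))
        refl a (lowerX f j k) (f (suc j) k) (f j k) (lowerX g j k) (g (suc j) k) (g j k)
        (μ * fromℕ (suc j)) (ν * fromℕ j))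

  lowerX-cong : ∀ {f g : Coeffs} → (∀ j k → f j k ≈ g j k) → ∀ j k → lowerX f j k ≈ lowerX g j k
  lowerX-cong f≈g j zero    = refl
  lowerX-cong f≈g j (suc k) = f≈g j k

  Xmul-coeffs-cong : ∀ {f g : Coeffs} → (∀ j k → f j k ≈ g j k) → ∀ j k → Xmul-coeffs f j k ≈ Xmul-coeffs g j k
  Xmul-coeffs-cong f≈g j k =
    +-cong (+-cong (lowerX-cong f≈g j k) (*-congˡ (f≈g (suc j) k))) (*-congˡ (f≈g j k))

  monomial : ℕ → ℕ → Coeffs
  monomial i m j k = δ i j * δ m k

  lowerX-monomial : ∀ i m j k → lowerX (monomial i m) j k ≈ monomial i (suc m) j k
  lowerX-monomial i m j zero    = sym (zeroʳ (δ i j))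
  lowerX-monomial i m j (suc k) = refl

  coeff-∷ : ∀ a i m e j k → coeff ((a , i , m) ∷ e) j k ≈ a * monomial i m j k + coeff e j k
  coeff-∷ a i m e j k with i ℕ.≟ j | m ℕ.≟ k
  ... | yes ≡.refl | yes ≡.refl = +-congʳ (sym (begin
    a * (δ i i * δ m m) ≈⟨ *-congˡ (*-cong (≡⇒≈ (δ-refl i)) (≡⇒≈ (δ-refl m))) ⟩
    a * (1# * 1#)       ≈⟨ *-congˡ (*-identityˡ 1#) ⟩
    a * 1#              ≈⟨ *-identityʳ a ⟩
    a                   ∎))
  ... | yes ≡.refl | no m≢k = sym (zero-summandˡ a _ (trans (*-congˡ (≡⇒≈ (δ-≢ m≢k))) (zeroʳ _)))
  ... | no i≢j | _ = sym (zero-summandˡ a _ (trans (*-congʳ (≡⇒≈ (δ-≢ i≢j))) (zeroˡ _)))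

  coeff-++ : ∀ e f j k → coeff (e ++ f) j k ≈ coeff e j k + coeff f j k
  coeff-++ [] f j k = sym (+-identityˡ _)
  coeff-++ ((a , i , m) ∷ e) f j k = begin
    coeff ((a , i , m) ∷ e ++ f) j k               ≈⟨ coeff-∷ a i m (e ++ f) j k ⟩
    a * monomial i m j k + coeff (e ++ f) j k       ≈⟨ +-congˡ (coeff-++ e f j k) ⟩
    a * monomial i m j k + (coeff e j k + coeff f j k) ≈⟨ +-assoc _ _ _ ⟨
    (a * monomial i m j k + coeff e j k) + coeff f j k ≈⟨ +-congʳ (coeff-∷ a i m e j k) ⟨
    coeff ((a , i , m) ∷ e) j k + coeff f j k      ∎

  coeff-scale : ∀ b e j k → coeff (scale b e) j k ≈ b * coeff e j k
  coeff-scale b [] j k = sym (zeroʳ b)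
  coeff-scale b ((a , i , m) ∷ e) j k = begin
    coeff ((b * a , i , m) ∷ scale b e) j k          ≈⟨ coeff-∷ (b * a) i m (scale b e) j k ⟩
    b * a * monomial i m j k + coeff (scale b e) j k ≈⟨ +-cong (*-assoc b a _) (coeff-scale b e j k) ⟩
    b * (a * monomial i m j k) + b * coeff e j k     ≈⟨ distribˡ b _ _ ⟨
    b * (a * monomial i m j k + coeff e j k)         ≈⟨ *-congˡ (coeff-∷ a i m e j k) ⟨
    b * coeff ((a , i , m) ∷ e) j k                  ∎

  coeff-Ymul-suc : ∀ e j k → coeff (Ymul e) (suc j) k ≈ coeff e j k
  coeff-Ymul-suc [] j k = refl
  coeff-Ymul-suc ((a , i , m) ∷ e) j k =
    trans (coeff-∷ a (suc i) m (Ymul e) (suc j) k)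
      (trans (+-congˡ (coeff-Ymul-suc e j k)) (sym (coeff-∷ a i m e j k)))

  coeff-Ymul-zero : ∀ e k → coeff (Ymul e) zero k ≈ 0#
  coeff-Ymul-zero [] k = refl
  coeff-Ymul-zero ((a , i , m) ∷ e) k =
    trans (coeff-∷ a (suc i) m (Ymul e) zero k)
      (trans (zero-summandˡ a _ (zeroˡ _)) (coeff-Ymul-zero e k))

  coeff-Xpow-+ʳ : ∀ m e j r → coeff (Xpow m e) j (r ℕ.+ m) ≈ coeff e j r
  coeff-Xpow-+ʳ m [] j r = refl
  coeff-Xpow-+ʳ m ((a , i , k) ∷ e) j r =
    trans (coeff-∷ a i (k ℕ.+ m) (Xpow m e) j (r ℕ.+ m))
      (trans (+-cong (*-congˡ (*-congˡ (≡⇒≈ (δ-+ʳ m k r)))) (coeff-Xpow-+ʳ m e j r))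
        (sym (coeff-∷ a i k e j r)))

  coeff-Xpow-< : ∀ m e j r → r < m → coeff (Xpow m e) j r ≈ 0#
  coeff-Xpow-< m [] j r r<m = refl
  coeff-Xpow-< m ((a , i , k) ∷ e) j r r<m =
    trans (coeff-∷ a i (k ℕ.+ m) (Xpow m e) j r)
      (trans (zero-summandˡ a _ (trans (*-congˡ (≡⇒≈ (δ-≢ k+m≢r))) (zeroʳ _))) (coeff-Xpow-< m e j r r<m))
    where
    k+m≢r : k ℕ.+ m ≢ r
    k+m≢r k+m≡r = <⇒≢ (<-≤-trans r<m (≡.subst (m ≤_) k+m≡r (m≤n+m m k))) ≡.refl

  Xmul-coeffs-monomial : ∀ i m j k → Xmul-coeffs (monomial i m) j k ≈
    (monomial i (suc m) j k + (μ * fromℕ (suc j)) * monomial i m (suc j) k) + (ν * fromℕ j) * monomial i m j k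
  Xmul-coeffs-monomial i m j k = +-congʳ (+-congʳ (lowerX-monomial i m j k))

  coeff-XY^ : ∀ i j k → coeff (XY^ i) j k ≈ Xmul-coeffs (monomial i 0) j k
  coeff-XY^ zero zero k = trans (coeff-∷ 1# 0 1 [] 0 k) (trans
    (solve 4 (λ m n d₁ d₀ → con 1 :* (con 1 :* d₁) :+ con 0
                := (con 1 :* d₁ :+ (m :* (con 1 :+ con 0)) :* (con 0 :* d₀)) :+ (n :* con 0) :* (con 1 :* d₀))
       refl μ ν (δ 1 k) (δ 0 k))
    (sym (Xmul-coeffs-monomial 0 0 0 k)))
  coeff-XY^ zero (suc j) k = trans (coeff-∷ 1# 0 1 [] (suc j) k) (trans
    (solve 4 (λ M N d₁ d₀ → con 1 :* (con 0 :* d₁) :+ con 0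
                := (con 0 :* d₁ :+ M :* (con 0 :* d₀)) :+ N :* (con 0 :* d₀))
       refl (μ * fromℕ (suc (suc j))) (ν * fromℕ (suc j)) (δ 1 k) (δ 0 k))
    (sym (Xmul-coeffs-monomial 0 0 (suc j) k)))
  coeff-XY^ (suc i) j k = begin
    coeff (XY^ (suc i)) j k
      ≈⟨ coeff-++ (Ymul (XY^ i)) _ j k ⟩
    coeff (Ymul (XY^ i)) j k + coeff ((μ , i , 0) ∷ (ν , suc i , 0) ∷ []) j k
      ≈⟨ +-congˡ (trans (coeff-∷ μ i 0 _ j k) (+-congˡ (coeff-∷ ν (suc i) 0 [] j k))) ⟩
    coeff (Ymul (XY^ i)) j k + (μ * monomial i 0 j k + (ν * monomial (suc i) 0 j k + 0#))
      ≈⟨ case-j j ⟩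
    (monomial (suc i) 1 j k + (μ * fromℕ (suc j)) * monomial (suc i) 0 (suc j) k) + (ν * fromℕ j) * monomial (suc i) 0 j k
      ≈⟨ Xmul-coeffs-monomial (suc i) 0 j k ⟨
    Xmul-coeffs (monomial (suc i) 0) j k ∎
    where
    case-j : ∀ j → coeff (Ymul (XY^ i)) j k + (μ * monomial i 0 j k + (ν * monomial (suc i) 0 j k + 0#)) ≈
      (monomial (suc i) 1 j k + (μ * fromℕ (suc j)) * monomial (suc i) 0 (suc j) k) + (ν * fromℕ j) * monomial (suc i) 0 j k
    case-j zero = trans (+-congʳ (coeff-Ymul-zero (XY^ i) k))
      (solve 5 (λ m n d d₁ d₀ → con 0 :+ (m :* (d :* d₀) :+ (n :* (con 0 :* d₀) :+ con 0))
                  := (con 0 :* d₁ :+ (m :* (con 1 :+ con 0)) :* (d :* d₀)) :+ (n :* con 0) :* (con 0 :* d₀))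
         refl μ ν (δ i 0) (δ 1 k) (δ 0 k))
    case-j (suc j) = trans (+-congʳ (trans (coeff-Ymul-suc (XY^ i) j k)
                                    (trans (coeff-XY^ i j k) (Xmul-coeffs-monomial i 0 j k))))
      (solve 7 (λ m n f d d' d₁ d₀ →
           ((d :* d₁ :+ (m :* (con 1 :+ f)) :* (d' :* d₀)) :+ (n :* f) :* (d :* d₀))
             :+ (m :* (d' :* d₀) :+ (n :* (d :* d₀) :+ con 0))
         := (d :* d₁ :+ (m :* (con 1 :+ (con 1 :+ f))) :* (d' :* d₀)) :+ (n :* (con 1 :+ f)) :* (d :* d₀))
         refl μ ν (fromℕ j) (δ i j) (δ i (suc j)) (δ 1 k) (δ 0 k))

  Xmul-coeffs-monomial-+ʳ : ∀ i m j r → Xmul-coeffs (monomial i m) j (r ℕ.+ m) ≈ Xmul-coeffs (monomial i 0) j r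
  Xmul-coeffs-monomial-+ʳ i m j r = begin
    Xmul-coeffs (monomial i m) j (r ℕ.+ m)
      ≈⟨ Xmul-coeffs-monomial i m j (r ℕ.+ m) ⟩
    (monomial i (1 ℕ.+ m) j (r ℕ.+ m) + (μ * fromℕ (suc j)) * monomial i (0 ℕ.+ m) (suc j) (r ℕ.+ m))
      + (ν * fromℕ j) * monomial i (0 ℕ.+ m) j (r ℕ.+ m)
      ≈⟨ +-cong (+-cong (shift j 1) (*-congˡ (shift (suc j) 0))) (*-congˡ (shift j 0)) ⟩
    (monomial i 1 j r + (μ * fromℕ (suc j)) * monomial i 0 (suc j) r) + (ν * fromℕ j) * monomial i 0 j r
      ≈⟨ Xmul-coeffs-monomial i 0 j r ⟨
    Xmul-coeffs (monomial i 0) j r ∎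
    where
    shift : ∀ j a → monomial i (a ℕ.+ m) j (r ℕ.+ m) ≈ monomial i a j r
    shift j a = *-congˡ (≡⇒≈ (δ-+ʳ m a r))

  Xmul-coeffs-monomial-< : ∀ i m j k → k < m → Xmul-coeffs (monomial i m) j k ≈ 0#
  Xmul-coeffs-monomial-< i m j k k<m = trans (Xmul-coeffs-monomial i m j k)
    (trans (+-cong (+-cong (vanish (suc m) (<⇒≢ (ℕ.m<n⇒m<1+n k<m))) (*-congˡ (vanish m (<⇒≢ k<m))))
                   (*-congˡ (vanish m (<⇒≢ k<m))))
      (solve 2 (λ M N → (con 0 :+ M :* con 0) :+ N :* con 0 := con 0) refl (μ * fromℕ (suc j)) (ν * fromℕ j)))
    where
    vanish : ∀ {j} m' → k ≢ m' → monomial i m' j k ≈ 0#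
    vanish m' k≢m' = trans (*-congˡ (≡⇒≈ (δ-≢ (≡.≢-sym k≢m')))) (zeroʳ _)

  coeff-Xpow-XY^ : ∀ m i j k → coeff (Xpow m (XY^ i)) j k ≈ Xmul-coeffs (monomial i m) j k
  coeff-Xpow-XY^ m i j k with k <? m
  ... | yes k<m = trans (coeff-Xpow-< m (XY^ i) j k k<m) (sym (Xmul-coeffs-monomial-< i m j k k<m))
  ... | no  k≮m = ≡.subst (λ k → coeff (Xpow m (XY^ i)) j k ≈ Xmul-coeffs (monomial i m) j k)
                    (m∸n+n≡m (≮⇒≥ k≮m)) (above (k ℕ.∸ m))
    where
    above : ∀ r → coeff (Xpow m (XY^ i)) j (r ℕ.+ m) ≈ Xmul-coeffs (monomial i m) j (r ℕ.+ m)
    above r = trans (coeff-Xpow-+ʳ m (XY^ i) j r)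
                (trans (coeff-XY^ i j r) (sym (Xmul-coeffs-monomial-+ʳ i m j r)))

  coeff-Xmul : ∀ e j k → coeff (Xmul e) j k ≈ Xmul-coeffs (coeff e) j k
  coeff-Xmul [] j k =
    sym (trans (+-cong (+-cong (lowerX-empty k) (zeroʳ _)) (zeroʳ _)) (trans (+-identityʳ _) (+-identityʳ 0#)))
    where
    lowerX-empty : ∀ k → lowerX (coeff []) j k ≈ 0#
    lowerX-empty zero    = refl
    lowerX-empty (suc k) = refl
  coeff-Xmul ((a , i , m) ∷ e) j k = begin
    coeff (scale a (Xpow m (XY^ i)) ++ Xmul e) j k
      ≈⟨ coeff-++ (scale a (Xpow m (XY^ i))) (Xmul e) j k ⟩
    coeff (scale a (Xpow m (XY^ i))) j k + coeff (Xmul e) j k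
      ≈⟨ +-cong (trans (coeff-scale a (Xpow m (XY^ i)) j k) (*-congˡ (coeff-Xpow-XY^ m i j k))) (coeff-Xmul e j k) ⟩
    a * Xmul-coeffs (monomial i m) j k + Xmul-coeffs (coeff e) j k
      ≈⟨ Xmul-coeffs-linear a (monomial i m) (coeff e) j k ⟨
    Xmul-coeffs (λ j k → a * monomial i m j k + coeff e j k) j k
      ≈⟨ Xmul-coeffs-cong (λ j k → coeff-∷ a i m e j k) j k ⟨
    Xmul-coeffs (coeff ((a , i , m) ∷ e)) j k ∎

  coeff-YX : ∀ w j k → coeff (nf (Y ∷ X ∷ w)) (suc j) k ≈ Xmul-coeffs (coeff (nf w)) j k
  coeff-YX w j k = trans (coeff-Ymul-suc (Xmul (nf w)) j k) (coeff-Xmul (nf w) j k)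

proposition2p9 : ∀ {c ℓ : Level} (R : CommutativeRing c ℓ) (μ ν : CommutativeRing.Carrier R)
    → let open CommutativeRing R in
      let open OreStirling R μ ν in
      ∀ (n : ℕ) (j k : ℤ) → + 1 ℤ.≤ j → + 0 ℤ.≤ k →
      S (suc n) j k ≈ (S n (j ℤ.- + 1) (k ℤ.- + 1) + (μ * fromℤ j) * S n j k)
                       + (ν * fromℤ (j ℤ.- + 1)) * S n (j ℤ.- + 1) k
-- The right-hand side computes to Xmul-coeffs (coeff (nf (YXpow n))) j k; k is split
-- only because lowerX and k ℤ.- + 1 reduce on constructors.
proposition2p9 R μ ν n (+ suc j) (+ zero)  (ℤ.+≤+ (s≤s _)) _ = NormalOrdering.coeff-YX R μ ν (OreStirling.YXpow R μ ν n) j zero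
proposition2p9 R μ ν n (+ suc j) (+ suc k) (ℤ.+≤+ (s≤s _)) _ = NormalOrdering.coeff-YX R μ ν (OreStirling.YXpow R μ ν n) j (suc k)
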